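{- For all integers $l \ge d \ge 0$ with $l > 0$, $A(l,d) \le l^d$.
   Context: A rooted binary tree is a rooted tree in which every vertex has at most two children; the empty tree (0 vertices) is allowed. $B_m$ is the complete binary tree with $m$ layers, and a subdivision of $B_m$ is obtained by replacing some edges by paths; it is rooted at the root of $B_m$. A subdivision $S$ of $B_m$ is contained in a rooted tree $T$ as a compatible subgraph if $S$ is (isomorphic to) a subtree of $T$ such that the root of $S$ is the vertex of this subtree closest to the root of $T$. For integers $l,d\ge 0$, $A(l,d)$ is the maximum number $n$ such that there exists a rooted binary tree on $n$ vertices with at most $l$ layers that does not contain a subdivision of $B_{d+1}$ as a compatible subgraph. -}

module Defs where

open import Data.Nat using (ℕ; zero; suc; _+_; _⊔_)

-- Rooted binary trees (each vertex has at most two children); `leaf` is the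
-- empty tree.  Children are stored in order (left/right), which represents
-- every rooted binary tree; containment below is symmetric in the two sides.
data BTree : Set where
  leaf : BTree
  node : BTree → BTree → BTree

size : BTree → ℕ
size leaf       = 0
size (node l r) = suc (size l + size r)

layers : BTree → ℕ
layers leaf       = 0
layers (node l r) = suc (layers l ⊔ layers r)

-- ContainsSub m t : t contains a subdivision of B_m (complete binary tree
-- with m layers) as a compatible subgraph, i.e. embedded so that the root of
-- the subdivision is the topmost vertex of its image.
--  * B_0 is empty: always contained.
--  * `here`: the subdivision is rooted at the root of t; for m+1 layers the
--    two branches go into the two child subtrees, each of which (from its own
--    root, via a possibly subdivided path) contains a subdivision of B_m.
--    For m = 0 this just says t is nonempty (B_1 is a single vertex).
--  * `left`/`right`: the subdivision lies in a child subtree.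
data ContainsSub : ℕ → BTree → Set where
  empty : ∀ {t} → ContainsSub zero t
  here  : ∀ {m l r} → ContainsSub m l → ContainsSub m r → ContainsSub (suc m) (node l r)
  left  : ∀ {m l r} → ContainsSub m l → ContainsSub m (node l r)
  right : ∀ {m l r} → ContainsSub m r → ContainsSub m (node l r)

module Submission where

-- Define the bound  avoidBound l d  by  0  for d = 0 and  l^d
-- for d ≥ 1, and show by induction on the tree that a tree with at most l
-- layers avoiding (a subdivision of) B_{d+1} has at most  avoidBound l d
-- vertices; this is at most l^d, which gives the theorem.
--   * A tree avoiding B_1 is empty, which is the case d = 0.
--   * If  node a b  avoids B_{d+2}, then one child avoids B_{d+1} (otherwise
--     the root together with both children yields B_{d+2}) and the other
--     still avoids B_{d+2}; both children have one layer fewer.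
--   * The induction closes by the arithmetic inequality
--       1 + avoidBound l d + l^{d+1} ≤ (l+1)^{d+1}.

open import Defs
open import Data.Nat using (ℕ; zero; suc; _+_; _*_; _≤_; _<_; _^_; z≤n; s≤s)
open import Data.Nat.Properties
  using (≤-refl; ≤-trans; n≤1+n; n<1+n; m≤m⊔n; m≤n⊔m; +-comm; +-mono-≤;
         +-monoʳ-≤; *-monoʳ-≤; ^-monoˡ-<; module ≤-Reasoning)
open import Data.Product using (_×_; _,_)
open import Data.Sum using (_⊎_; inj₁; inj₂)
open import Data.Empty using (⊥-elim)
open import Relation.Binary.PropositionalEquality using (cong; subst)
open import Relation.Nullary using (¬_; Dec; yes; no)

-- Containing a subdivision of B_m is decidable; needed to decide which child
-- of a vertex avoids the smaller complete tree.
containsSub? : ∀ m t → Dec (ContainsSub m t)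
containsSub? zero    t          = yes empty
containsSub? (suc m) leaf       = no λ ()
containsSub? (suc m) (node a b)
  with containsSub? m a | containsSub? m b | containsSub? (suc m) a | containsSub? (suc m) b
... | yes p  | yes q  | _      | _      = yes (here p q)
... | _      | _      | yes p  | _      = yes (left p)
... | _      | _      | _      | yes p  = yes (right p)
... | no ¬p  | _      | no ¬pa | no ¬pb =
  no λ { (here p _) → ¬p p ; (left p) → ¬pa p ; (right p) → ¬pb p }
... | yes _  | no ¬q  | no ¬pa | no ¬pb =
  no λ { (here _ q) → ¬q q ; (left p) → ¬pa p ; (right p) → ¬pb p }

avoid-split : ∀ {m a b} → ¬ ContainsSub (suc m) (node a b) →
              (¬ ContainsSub m a × ¬ ContainsSub (suc m) b) ⊎
              (¬ ContainsSub (suc m) a × ¬ ContainsSub m b)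
avoid-split {m} {a} ¬c with containsSub? m a
... | no ¬p = inj₁ (¬p , λ q → ¬c (right q))
... | yes p = inj₂ ((λ q → ¬c (left q)) , λ q → ¬c (here p q))

avoidBound : ℕ → ℕ → ℕ
avoidBound l zero    = 0
avoidBound l (suc d) = l ^ suc d

avoidBound≤pow : ∀ l d → avoidBound l d ≤ l ^ d
avoidBound≤pow l zero    = z≤n
avoidBound≤pow l (suc d) = ≤-refl

-- The arithmetic heart of the induction:  1 + avoidBound l d + l^{d+1} ≤ (l+1)^{d+1}.
-- For d ≥ 1 it follows from  (l+1)^d ≥ l^d + 1  after multiplying by l+1.
avoidBound-gap : ∀ l d → suc (avoidBound l d + l ^ suc d) ≤ suc l ^ suc d
avoidBound-gap l zero    = ≤-refl
avoidBound-gap l (suc e) = begin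
  suc (x + l * x)      ≤⟨ s≤s (+-monoʳ-≤ x (*-monoʳ-≤ l (n≤1+n x))) ⟩
  suc l * suc x        ≤⟨ *-monoʳ-≤ (suc l) (^-monoˡ-< (suc e) (n<1+n l)) ⟩
  suc l * suc l ^ suc e ∎
  where
  open ≤-Reasoning
  x = l ^ suc e

avoidBound-step : ∀ l d {x y} → x ≤ avoidBound l d → y ≤ avoidBound l (suc d) →
                  suc (x + y) ≤ avoidBound (suc l) (suc d)
avoidBound-step l d x≤ y≤ = ≤-trans (s≤s (+-mono-≤ x≤ y≤)) (avoidBound-gap l d)

size≤avoidBound : ∀ t l → layers t ≤ l → ∀ d → ¬ ContainsSub (suc d) t →
                  size t ≤ avoidBound l d
size≤avoidBound leaf       l       _         d       _  = z≤n
size≤avoidBound (node a b) zero    ()        d       _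
size≤avoidBound (node a b) (suc l) _         zero    ¬c = ⊥-elim (¬c (here empty empty))
size≤avoidBound (node a b) (suc l) (s≤s lay) (suc d) ¬c =
  combine (avoid-split ¬c)
  where
  bound-a : ∀ k → ¬ ContainsSub (suc k) a → size a ≤ avoidBound l k
  bound-a = size≤avoidBound a l (≤-trans (m≤m⊔n (layers a) (layers b)) lay)
  bound-b : ∀ k → ¬ ContainsSub (suc k) b → size b ≤ avoidBound l k
  bound-b = size≤avoidBound b l (≤-trans (m≤n⊔m (layers a) (layers b)) lay)

  combine : (¬ ContainsSub (suc d) a × ¬ ContainsSub (suc (suc d)) b) ⊎
            (¬ ContainsSub (suc (suc d)) a × ¬ ContainsSub (suc d) b) →
            size (node a b) ≤ avoidBound (suc l) (suc d)
  combine (inj₁ (¬ca , ¬cb)) = avoidBound-step l d (bound-a d ¬ca) (bound-b (suc d) ¬cb)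
  combine (inj₂ (¬ca , ¬cb)) =
    subst (_≤ avoidBound (suc l) (suc d)) (cong suc (+-comm (size b) (size a)))
      (avoidBound-step l d (bound-b d ¬cb) (bound-a (suc d) ¬ca))

lemma17 : (l d : ℕ) → d ≤ l → 0 < l → (t : BTree) →
    layers t ≤ l → ¬ ContainsSub (suc d) t → size t ≤ l ^ d
lemma17 l d _ _ t lay ¬c = ≤-trans (size≤avoidBound t l lay d ¬c) (avoidBound≤pow l d)
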